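{- Let $M\ge 1$ and let $H\subseteq\mathbb{Z}_M$ be a union of step classes with $0\in H$. There exists a tiling $A\oplus B=\mathbb{Z}_M$ with $\mathrm{Div}^\ast(A)\subseteq H$ and $\mathrm{Div}^\ast(B)\subseteq H'$ if and only if $\omega(H)\,\omega(H')=M$.
   Context: For $m\mid M$, the step class is $R_m=\{z\in\mathbb{Z}_M:\gcd(z,M)=m\}$ (with $\gcd(0,M)=M$). A tiling $A\oplus B=\mathbb{Z}_M$ means $A,B\subseteq\mathbb{Z}_M$ and every element of $\mathbb{Z}_M$ is uniquely of the form $a+b$ with $a\in A$, $b\in B$. For $A\subseteq\mathbb{Z}_M$, $\mathrm{Div}(A)=\{\gcd(a-a',M):a,a'\in A\}$ and $\mathrm{Div}^\ast(A)=\bigcup_{d\in\mathrm{Div}(A)}R_d$. The standard complement of $H$ is $H'=(\mathbb{Z}_M\setminus H)\cup\{0\}$. $\Gamma_H$ is the graph with vertex set $\mathbb{Z}_M$ in which distinct $x,y$ are adjacent iff $x-y\in H$, and $\omega(H)$ is the maximum size of a clique in $\Gamma_H$. -}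

module Defs where

open import Data.Nat using (ℕ; zero; suc; _+_; _∸_; _*_; _≤_)
open import Data.Nat.DivMod using (_%_; m%n<n)
open import Data.Nat.GCD using (gcd)
open import Data.Fin using (Fin; toℕ; fromℕ<)
open import Data.Fin.Subset using (Subset; _∈_; _∉_; ∁; _∪_; ⁅_⁆; ∣_∣)
open import Data.Product using (Σ; ∃; ∃-syntax; ∃!; _×_; _,_)
open import Relation.Binary.PropositionalEquality using (_≡_)
open import Relation.Nullary using (¬_)

-- Throughout, Z_M with M = suc n (so M ≥ 1); elements are Fin M.
module _ (n : ℕ) where
  M : ℕ
  M = suc n

  ZM : Set
  ZM = Fin M

  _⊕_ : ZM → ZM → ZM
  x ⊕ y = fromℕ< (m%n<n (toℕ x + toℕ y) M)

  _⊖_ : ZM → ZM → ZM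
  x ⊖ y = fromℕ< (m%n<n (toℕ x + (M ∸ toℕ y)) M)

  -- gcd(z, M), with gcd(0, M) = M automatically
  gcdM : ZM → ℕ
  gcdM z = gcd (toℕ z) M

  R : ℕ → ZM → Set
  R m z = gcdM z ≡ m

  UnionOfStepClasses : Subset M → Set
  UnionOfStepClasses H = ∀ x y → gcdM x ≡ gcdM y → x ∈ H → y ∈ H

  compl : Subset M → Subset M
  compl H = ∁ H ∪ ⁅ Fin.zero ⁆

  Div : Subset M → ℕ → Set
  Div A d = ∃[ a ] ∃[ a' ] (a ∈ A × a' ∈ A × gcdM (a ⊖ a') ≡ d)

  DivStar : Subset M → ZM → Set
  DivStar A z = ∃[ d ] (Div A d × R d z)

  SubsetOf : (ZM → Set) → Subset M → Set
  SubsetOf P S = ∀ z → P z → z ∈ S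

  Tiling : Subset M → Subset M → Set
  Tiling A B = ∀ z → ∃! _≡_ (λ (p : ZM × ZM) → let (a , b) = p in
                       a ∈ A × b ∈ B × a ⊕ b ≡ z)

  -- cliques in Γ_H: distinct x,y adjacent iff x - y ∈ H
  IsClique : Subset M → Subset M → Set
  IsClique H C = ∀ x y → x ∈ C → y ∈ C → ¬ x ≡ y → (x ⊖ y) ∈ H

  IsCliqueNumber : Subset M → ℕ → Set
  IsCliqueNumber H k = (∃[ C ] (IsClique H C × ∣ C ∣ ≡ k))
                     × (∀ C → IsClique H C → ∣ C ∣ ≤ k)

-- If C is a clique of Γ_H and D one of Γ_H′, then (c , d) ↦ c + d is injective on C × D:
-- c + d = c′ + d′ makes c − c′ = d′ − d lie in both H ∪ {0} and H′, hence vanish. So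
-- |C| |D| ≤ M, with equality exactly when C ⊕ D = Z_M. The summands of a tiling with
-- Div*(A) ⊆ H and Div*(B) ⊆ H′ are such cliques, which forces ω(H) ω(H′) = M. Conversely,
-- maximum cliques whose sizes multiply to M tile Z_M, and their Div* lie in H and H′
-- because both sets contain 0 and are unions of step classes.
module Submission where

open import Data.Nat using (ℕ; zero; suc; _+_; _∸_; _*_; _≤_; NonZero; s≤s⁻¹)
open import Data.Nat.Properties using (+-assoc; +-comm; m∸n+n≡m; m+[n∸m]≡n; <⇒≤; ≤-trans; ≤-antisym; ≤-reflexive; <-irrefl; *-mono-≤; ≤∧≢⇒<; module ≤-Reasoning) renaming (_≟_ to _≟ℕ_)
open import Data.Nat.DivMod using (_%_; m%n<n; %-distribˡ-+; m%n%n≡m%n; [m+n]%n≡m%n; m<n⇒m%n≡m; n%n≡0)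
open import Data.Nat.Divisibility using (_∣_; n∣m⇒m%n≡0)
open import Data.Nat.GCD using (gcd[m,n]∣m)
open import Data.Fin using (Fin; toℕ; punchOut; combine; remQuot)
open import Data.Fin.Properties using (toℕ-fromℕ<; toℕ-injective; toℕ<n; suc-injective; injective⇒≤; punchOut-injective; combine-remQuot; remQuot-combine; any?; all?) renaming (_≟_ to _≟ᶠ_)
open import Data.Fin.Subset using (Subset; _∈_; _∉_; ∁; ⁅_⁆; ∣_∣; ⊥; inside; outside)
open import Data.Fin.Subset.Properties using (_∈?_; x∈p∪q⁻; x∈p∪q⁺; x∈∁p⇒x∉p; x∉p⇒x∈∁p; x∈⁅x⁆; x∈⁅y⁆⇒x≡y; ∉⊥; ∣⊥∣≡0; ∣p∣≤n; anySubset?)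
open import Data.Vec.Base using (_∷_; here; there)
open import Data.Product using (∃; ∃-syntax; _×_; _,_; proj₁; proj₂; map; uncurry)
open import Data.Product.Properties using (×-≡,≡→≡)
open import Data.Sum using (_⊎_; inj₁; inj₂; [_,_]′)
open import Function using (id)
open import Function.Bundles using (_⇔_; mk⇔)
open import Function.Definitions using (Injective)
open import Relation.Nullary using (yes; no; contradiction; ¬?)
open import Relation.Nullary.Decidable using (_×-dec_; _→-dec_)
open import Relation.Unary using (Decidable)
open import Relation.Binary.PropositionalEquality using (_≡_; _≢_; refl; sym; trans; cong; cong₂; subst; module ≡-Reasoning)

open import Defs hiding (_⊕_; _⊖_)
import Defs

[m%d+n]%d≡[m+n]%d : ∀ m n d .{{_ : NonZero d}} → (m % d + n) % d ≡ (m + n) % d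
[m%d+n]%d≡[m+n]%d m n d = begin
  (m % d + n) % d         ≡⟨ %-distribˡ-+ (m % d) n d ⟩
  (m % d % d + n % d) % d ≡⟨ cong (λ t → (t + n % d) % d) (m%n%n≡m%n m d) ⟩
  (m % d + n % d) % d     ≡⟨ %-distribˡ-+ m n d ⟨
  (m + n) % d             ∎
  where open ≡-Reasoning

[m+n%d]%d≡[m+n]%d : ∀ m n d .{{_ : NonZero d}} → (m + n % d) % d ≡ (m + n) % d
[m+n%d]%d≡[m+n]%d m n d = begin
  (m + n % d) % d ≡⟨ cong (_% d) (+-comm m (n % d)) ⟩
  (n % d + m) % d ≡⟨ [m%d+n]%d≡[m+n]%d n m d ⟩
  (n + m) % d     ≡⟨ cong (_% d) (+-comm n m) ⟩
  (m + n) % d     ∎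
  where open ≡-Reasoning

module _ {n : ℕ} where

  infixl 6 _⊕_ _⊖_

  _⊕_ _⊖_ : ZM n → ZM n → ZM n
  _⊕_ = Defs._⊕_ n
  _⊖_ = Defs._⊖_ n

  private
    m : ℕ
    m = suc n

  toℕ-⊕ : ∀ (x y : ZM n) → toℕ (x ⊕ y) ≡ (toℕ x + toℕ y) % m
  toℕ-⊕ x y = toℕ-fromℕ< (m%n<n (toℕ x + toℕ y) m)

  toℕ-⊖ : ∀ (x y : ZM n) → toℕ (x ⊖ y) ≡ (toℕ x + (m ∸ toℕ y)) % m
  toℕ-⊖ x y = toℕ-fromℕ< (m%n<n (toℕ x + (m ∸ toℕ y)) m)

  toℕ%m≡toℕ : ∀ (x : ZM n) → toℕ x % m ≡ toℕ x
  toℕ%m≡toℕ x = m<n⇒m%n≡m (toℕ<n x)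

  [toℕ+m]%m≡toℕ : ∀ (x : ZM n) → (toℕ x + m) % m ≡ toℕ x
  [toℕ+m]%m≡toℕ x = trans ([m+n]%n≡m%n (toℕ x) m) (toℕ%m≡toℕ x)

  ⊕-comm : ∀ (x y : ZM n) → x ⊕ y ≡ y ⊕ x
  ⊕-comm x y = toℕ-injective (begin
    toℕ (x ⊕ y)          ≡⟨ toℕ-⊕ x y ⟩
    (toℕ x + toℕ y) % m  ≡⟨ cong (_% m) (+-comm (toℕ x) (toℕ y)) ⟩
    (toℕ y + toℕ x) % m  ≡⟨ toℕ-⊕ y x ⟨
    toℕ (y ⊕ x)          ∎)
    where open ≡-Reasoning

  ⊕-assoc : ∀ (x y z : ZM n) → x ⊕ y ⊕ z ≡ x ⊕ (y ⊕ z)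
  ⊕-assoc x y z = toℕ-injective (begin
    toℕ (x ⊕ y ⊕ z)                   ≡⟨ toℕ-⊕ (x ⊕ y) z ⟩
    (toℕ (x ⊕ y) + toℕ z) % m         ≡⟨ cong (λ t → (t + toℕ z) % m) (toℕ-⊕ x y) ⟩
    ((toℕ x + toℕ y) % m + toℕ z) % m ≡⟨ [m%d+n]%d≡[m+n]%d (toℕ x + toℕ y) (toℕ z) m ⟩
    (toℕ x + toℕ y + toℕ z) % m       ≡⟨ cong (_% m) (+-assoc (toℕ x) (toℕ y) (toℕ z)) ⟩
    (toℕ x + (toℕ y + toℕ z)) % m     ≡⟨ [m+n%d]%d≡[m+n]%d (toℕ x) (toℕ y + toℕ z) m ⟨
    (toℕ x + (toℕ y + toℕ z) % m) % m ≡⟨ cong (λ t → (toℕ x + t) % m) (toℕ-⊕ y z) ⟨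
    (toℕ x + toℕ (y ⊕ z)) % m         ≡⟨ toℕ-⊕ x (y ⊕ z) ⟨
    toℕ (x ⊕ (y ⊕ z))                 ∎)
    where open ≡-Reasoning

  ⊕-identityˡ : ∀ (x : ZM n) → Fin.zero ⊕ x ≡ x
  ⊕-identityˡ x = toℕ-injective (trans (toℕ-⊕ Fin.zero x) (toℕ%m≡toℕ x))

  x⊖y⊕y≡x : ∀ (x y : ZM n) → x ⊖ y ⊕ y ≡ x
  x⊖y⊕y≡x x y = toℕ-injective (begin
    toℕ (x ⊖ y ⊕ y)                             ≡⟨ toℕ-⊕ (x ⊖ y) y ⟩
    (toℕ (x ⊖ y) + toℕ y) % m                   ≡⟨ cong (λ t → (t + toℕ y) % m) (toℕ-⊖ x y) ⟩
    ((toℕ x + (m ∸ toℕ y)) % m + toℕ y) % m     ≡⟨ [m%d+n]%d≡[m+n]%d (toℕ x + (m ∸ toℕ y)) (toℕ y) m ⟩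
    (toℕ x + (m ∸ toℕ y) + toℕ y) % m           ≡⟨ cong (_% m) (+-assoc (toℕ x) (m ∸ toℕ y) (toℕ y)) ⟩
    (toℕ x + (m ∸ toℕ y + toℕ y)) % m           ≡⟨ cong (λ t → (toℕ x + t) % m) (m∸n+n≡m (<⇒≤ (toℕ<n y))) ⟩
    (toℕ x + m) % m                             ≡⟨ [toℕ+m]%m≡toℕ x ⟩
    toℕ x                                       ∎)
    where open ≡-Reasoning

  x⊕y⊖y≡x : ∀ (x y : ZM n) → x ⊕ y ⊖ y ≡ x
  x⊕y⊖y≡x x y = toℕ-injective (begin
    toℕ (x ⊕ y ⊖ y)                             ≡⟨ toℕ-⊖ (x ⊕ y) y ⟩
    (toℕ (x ⊕ y) + (m ∸ toℕ y)) % m             ≡⟨ cong (λ t → (t + (m ∸ toℕ y)) % m) (toℕ-⊕ x y) ⟩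
    ((toℕ x + toℕ y) % m + (m ∸ toℕ y)) % m     ≡⟨ [m%d+n]%d≡[m+n]%d (toℕ x + toℕ y) (m ∸ toℕ y) m ⟩
    (toℕ x + toℕ y + (m ∸ toℕ y)) % m           ≡⟨ cong (_% m) (+-assoc (toℕ x) (toℕ y) (m ∸ toℕ y)) ⟩
    (toℕ x + (toℕ y + (m ∸ toℕ y))) % m         ≡⟨ cong (λ t → (toℕ x + t) % m) (m+[n∸m]≡n (<⇒≤ (toℕ<n y))) ⟩
    (toℕ x + m) % m                             ≡⟨ [toℕ+m]%m≡toℕ x ⟩
    toℕ x                                       ∎)
    where open ≡-Reasoning

  x⊖x≡0 : ∀ (x : ZM n) → x ⊖ x ≡ Fin.zero
  x⊖x≡0 x = toℕ-injective (begin
    toℕ (x ⊖ x)                  ≡⟨ toℕ-⊖ x x ⟩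
    (toℕ x + (m ∸ toℕ x)) % m    ≡⟨ cong (_% m) (m+[n∸m]≡n (<⇒≤ (toℕ<n x))) ⟩
    m % m                        ≡⟨ n%n≡0 m ⟩
    0                            ∎)
    where open ≡-Reasoning

  ⊕-cancelʳ : ∀ (x x′ y : ZM n) → x ⊕ y ≡ x′ ⊕ y → x ≡ x′
  ⊕-cancelʳ x x′ y eq = begin
    x           ≡⟨ x⊕y⊖y≡x x y ⟨
    x ⊕ y ⊖ y   ≡⟨ cong (_⊖ y) eq ⟩
    x′ ⊕ y ⊖ y  ≡⟨ x⊕y⊖y≡x x′ y ⟩
    x′          ∎
    where open ≡-Reasoning

  x⊖y≡0⇒x≡y : ∀ (x y : ZM n) → x ⊖ y ≡ Fin.zero → x ≡ y
  x⊖y≡0⇒x≡y x y eq = begin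
    x                 ≡⟨ x⊖y⊕y≡x x y ⟨
    x ⊖ y ⊕ y         ≡⟨ cong (_⊕ y) eq ⟩
    Fin.zero ⊕ y      ≡⟨ ⊕-identityˡ y ⟩
    y                 ∎
    where open ≡-Reasoning

  ⊕≡⊕⇒⊖≡⊖ : ∀ (c d c′ d′ : ZM n) → c ⊕ d ≡ c′ ⊕ d′ → c ⊖ c′ ≡ d′ ⊖ d
  ⊕≡⊕⇒⊖≡⊖ c d c′ d′ eq = ⊕-cancelʳ (c ⊖ c′) (d′ ⊖ d) (c′ ⊕ d) (begin
    c ⊖ c′ ⊕ (c′ ⊕ d)    ≡⟨ ⊕-assoc (c ⊖ c′) c′ d ⟨
    c ⊖ c′ ⊕ c′ ⊕ d      ≡⟨ cong (_⊕ d) (x⊖y⊕y≡x c c′) ⟩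
    c ⊕ d                ≡⟨ eq ⟩
    c′ ⊕ d′              ≡⟨ cong (c′ ⊕_) (x⊖y⊕y≡x d′ d) ⟨
    c′ ⊕ (d′ ⊖ d ⊕ d)    ≡⟨ ⊕-assoc c′ (d′ ⊖ d) d ⟨
    c′ ⊕ (d′ ⊖ d) ⊕ d    ≡⟨ cong (_⊕ d) (⊕-comm c′ (d′ ⊖ d)) ⟩
    d′ ⊖ d ⊕ c′ ⊕ d      ≡⟨ ⊕-assoc (d′ ⊖ d) c′ d ⟩
    d′ ⊖ d ⊕ (c′ ⊕ d)    ∎)
    where open ≡-Reasoning

enumerate : ∀ {m} (p : Subset m) → Fin ∣ p ∣ → Fin m
enumerate (inside ∷ p)  Fin.zero    = Fin.zero
enumerate (inside ∷ p)  (Fin.suc i) = Fin.suc (enumerate p i)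
enumerate (outside ∷ p) i           = Fin.suc (enumerate p i)

enumerate-∈ : ∀ {m} (p : Subset m) i → enumerate p i ∈ p
enumerate-∈ (inside ∷ p)  Fin.zero    = here
enumerate-∈ (inside ∷ p)  (Fin.suc i) = there (enumerate-∈ p i)
enumerate-∈ (outside ∷ p) i           = there (enumerate-∈ p i)

enumerate-injective : ∀ {m} (p : Subset m) → Injective _≡_ _≡_ (enumerate p)
enumerate-injective (inside ∷ p)  {Fin.zero}  {Fin.zero}  _  = refl
enumerate-injective (inside ∷ p)  {Fin.suc i} {Fin.suc j} eq =
  cong Fin.suc (enumerate-injective p (suc-injective eq))
enumerate-injective (outside ∷ p) eq = enumerate-injective p (suc-injective eq)

position : ∀ {m} (p : Subset m) {x} → x ∈ p → Fin ∣ p ∣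
position (inside ∷ p)  here        = Fin.zero
position (inside ∷ p)  (there x∈p) = Fin.suc (position p x∈p)
position (outside ∷ p) (there x∈p) = position p x∈p

enumerate-position : ∀ {m} (p : Subset m) {x} (x∈p : x ∈ p) → enumerate p (position p x∈p) ≡ x
enumerate-position (inside ∷ p)  here        = refl
enumerate-position (inside ∷ p)  (there x∈p) = cong Fin.suc (enumerate-position p x∈p)
enumerate-position (outside ∷ p) (there x∈p) = cong Fin.suc (enumerate-position p x∈p)

surjective⇒≤ : ∀ {m n} {f : Fin m → Fin n} → (∀ y → ∃ λ x → f x ≡ y) → n ≤ m
surjective⇒≤ {f = f} surj = injective⇒≤ section-injective
  where
  section-injective : Injective _≡_ _≡_ (λ y → proj₁ (surj y))
  section-injective {y} {y′} eq =
    trans (sym (proj₂ (surj y))) (trans (cong f eq) (proj₂ (surj y′)))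

injective⇒surjective : ∀ {m n} {f : Fin m → Fin n} → Injective _≡_ _≡_ f → n ≤ m →
                       ∀ y → ∃ λ x → f x ≡ y
injective⇒surjective {m} {suc n} {f} f-inj n≤m y with any? (λ x → f x ≟ᶠ y)
... | yes hit = hit
... | no miss = contradiction (≤-trans n≤m (injective⇒≤ avoid-y-injective)) (<-irrefl refl)
  where
  f≢y : ∀ x → y ≢ f x
  f≢y x eq = miss (x , sym eq)
  avoid-y-injective : Injective _≡_ _≡_ (λ x → punchOut (f≢y x))
  avoid-y-injective eq = f-inj (punchOut-injective (f≢y _) (f≢y _) eq)

remQuot-injective : ∀ {m} n → Injective _≡_ _≡_ (remQuot {m} n)
remQuot-injective {m} n {k} {k′} eq =
  trans (sym (combine-remQuot {m} n k)) (trans (cong (uncurry combine) eq) (combine-remQuot {m} n k′))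

module _ {n : ℕ} where

  ∈compl⁻ : ∀ {H : Subset (suc n)} {x} → x ∈ compl n H → x ∉ H ⊎ x ≡ Fin.zero
  ∈compl⁻ {H} x∈H′ with x∈p∪q⁻ (∁ H) ⁅ Fin.zero ⁆ x∈H′
  ... | inj₁ x∈∁H  = inj₁ (x∈∁p⇒x∉p x∈∁H)
  ... | inj₂ x∈⁅0⁆ = inj₂ (x∈⁅y⁆⇒x≡y Fin.zero x∈⁅0⁆)

  ∉⇒∈compl : ∀ {H : Subset (suc n)} {x} → x ∉ H → x ∈ compl n H
  ∉⇒∈compl x∉H = x∈p∪q⁺ (inj₁ (x∉p⇒x∈∁p x∉H))

  zero∈compl : ∀ (H : Subset (suc n)) → Fin.zero ∈ compl n H
  zero∈compl H = x∈p∪q⁺ (inj₂ (x∈⁅x⁆ Fin.zero))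

  ∈∧∈compl⇒≡zero : ∀ {H : Subset (suc n)} {x} → x ∈ H → x ∈ compl n H → x ≡ Fin.zero
  ∈∧∈compl⇒≡zero x∈H x∈H′ with ∈compl⁻ x∈H′
  ... | inj₁ x∉H = contradiction x∈H x∉H
  ... | inj₂ x≡0 = x≡0

  gcdM≡M⇒≡zero : ∀ (z : ZM n) → gcdM n z ≡ M n → z ≡ Fin.zero
  gcdM≡M⇒≡zero z eq = toℕ-injective (begin
    toℕ z           ≡⟨ m<n⇒m%n≡m (toℕ<n z) ⟨
    toℕ z % M n     ≡⟨ n∣m⇒m%n≡0 (toℕ z) (M n) M∣z ⟩
    0               ∎)
    where
    open ≡-Reasoning
    M∣z : M n ∣ toℕ z
    M∣z = subst (_∣ toℕ z) eq (gcd[m,n]∣m (toℕ z) (M n))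

  compl-unionOfStepClasses : ∀ {H : Subset (suc n)} →
                             UnionOfStepClasses n H → UnionOfStepClasses n (compl n H)
  compl-unionOfStepClasses {H} H-union x y gx≡gy x∈H′ with ∈compl⁻ x∈H′ | y ∈? H
  ... | inj₂ refl | _       = subst (_∈ compl n H) (sym (gcdM≡M⇒≡zero y (sym gx≡gy))) (zero∈compl H)
  ... | inj₁ x∉H  | yes y∈H = contradiction (H-union y x (sym gx≡gy) y∈H) x∉H
  ... | inj₁ _    | no y∉H  = ∉⇒∈compl y∉H

  clique-⊖ : ∀ {K C : Subset (suc n)} → IsClique n K C →
             ∀ {x y} → x ∈ C → y ∈ C → x ⊖ y ≡ Fin.zero ⊎ x ⊖ y ∈ K
  clique-⊖ C-clique {x} {y} x∈C y∈C with x ≟ᶠ y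
  ... | yes refl = inj₁ (x⊖x≡0 x)
  ... | no x≢y   = inj₂ (C-clique x y x∈C y∈C x≢y)

  DivStar⊆⇒isClique : ∀ {K A : Subset (suc n)} → SubsetOf n (DivStar n A) K → IsClique n K A
  DivStar⊆⇒isClique A⊆K x y x∈A y∈A _ =
    A⊆K (x ⊖ y) (gcdM n (x ⊖ y) , (x , y , x∈A , y∈A , refl) , refl)

  isClique⇒DivStar⊆ : ∀ {K C : Subset (suc n)} → UnionOfStepClasses n K → Fin.zero ∈ K →
                      IsClique n K C → SubsetOf n (DivStar n C) K
  isClique⇒DivStar⊆ {K} K-union 0∈K C-clique z (d , (x , y , x∈C , y∈C , gcd≡d) , z∈R) =
    K-union (x ⊖ y) z (trans gcd≡d (sym z∈R))
      ([ (λ x⊖y≡0 → subst (_∈ K) (sym x⊖y≡0) 0∈K) , id ]′ (clique-⊖ C-clique x∈C y∈C))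

  sumPair : ∀ (A B : Subset (suc n)) → Fin ∣ A ∣ × Fin ∣ B ∣ → ZM n
  sumPair A B (i , j) = enumerate A i ⊕ enumerate B j

  sumIndex : ∀ (A B : Subset (suc n)) → Fin (∣ A ∣ * ∣ B ∣) → ZM n
  sumIndex A B k = sumPair A B (remQuot {∣ A ∣} ∣ B ∣ k)

  tiling⇒sumIndex-surjective : ∀ {A B : Subset (suc n)} → Tiling n A B →
                               ∀ z → ∃ λ k → sumIndex A B k ≡ z
  tiling⇒sumIndex-surjective {A} {B} tiling z with tiling z
  ... | (a , b) , (a∈A , b∈B , a⊕b≡z) , _ = combine i j , (begin
    sumIndex A B (combine i j)     ≡⟨ cong (sumPair A B) (remQuot-combine i j) ⟩
    enumerate A i ⊕ enumerate B j  ≡⟨ cong₂ _⊕_ (enumerate-position A a∈A) (enumerate-position B b∈B) ⟩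
    a ⊕ b                          ≡⟨ a⊕b≡z ⟩
    z                              ∎)
    where
    open ≡-Reasoning
    i : Fin ∣ A ∣
    i = position A a∈A
    j : Fin ∣ B ∣
    j = position B b∈B

  module _ {H C D : Subset (suc n)}
           (C-clique : IsClique n H C) (D-clique : IsClique n (compl n H) D) where

    ⊕-injective-on-cliques : ∀ {c c′ d d′} → c ∈ C → c′ ∈ C → d ∈ D → d′ ∈ D →
                             c ⊕ d ≡ c′ ⊕ d′ → c ≡ c′ × d ≡ d′
    ⊕-injective-on-cliques {c} {c′} {d} {d′} c∈C c′∈C d∈D d′∈D eq =
      x⊖y≡0⇒x≡y c c′ c⊖c′≡0 , sym (x⊖y≡0⇒x≡y d′ d (trans (sym swap) c⊖c′≡0))
      where
      swap : c ⊖ c′ ≡ d′ ⊖ d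
      swap = ⊕≡⊕⇒⊖≡⊖ c d c′ d′ eq
      c⊖c′≡0 : c ⊖ c′ ≡ Fin.zero
      c⊖c′≡0 with clique-⊖ C-clique c∈C c′∈C | clique-⊖ D-clique d′∈D d∈D
      ... | inj₁ c⊖c′≡0 | _           = c⊖c′≡0
      ... | inj₂ _      | inj₁ d′⊖d≡0 = trans swap d′⊖d≡0
      ... | inj₂ c⊖c′∈H | inj₂ d′⊖d∈H′ =
        ∈∧∈compl⇒≡zero c⊖c′∈H (subst (_∈ compl n H) (sym swap) d′⊖d∈H′)

    sumPair-injective : Injective _≡_ _≡_ (sumPair C D)
    sumPair-injective {i , j} {i′ , j′} eq = ×-≡,≡→≡
      (map (enumerate-injective C) (enumerate-injective D)
        (⊕-injective-on-cliques (enumerate-∈ C i) (enumerate-∈ C i′)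
                                (enumerate-∈ D j) (enumerate-∈ D j′) eq))

    sumIndex-injective : Injective _≡_ _≡_ (sumIndex C D)
    sumIndex-injective eq = remQuot-injective {∣ C ∣} ∣ D ∣ (sumPair-injective eq)

    sumPair-surjective : M n ≤ ∣ C ∣ * ∣ D ∣ → ∀ z → ∃ λ ij → sumPair C D ij ≡ z
    sumPair-surjective M≤∣C∣∣D∣ z =
      map (remQuot {∣ C ∣} ∣ D ∣) id
          (injective⇒surjective {f = sumIndex C D} sumIndex-injective M≤∣C∣∣D∣ z)

    cliques⇒tiling : M n ≤ ∣ C ∣ * ∣ D ∣ → Tiling n C D
    cliques⇒tiling M≤∣C∣∣D∣ z =
      let ((i , j) , sum≡z) = sumPair-surjective M≤∣C∣∣D∣ z in
      (enumerate C i , enumerate D j) , (enumerate-∈ C i , enumerate-∈ D j , sum≡z) ,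
      λ (c∈C , d∈D , c⊕d≡z) → ×-≡,≡→≡
        (⊕-injective-on-cliques (enumerate-∈ C i) c∈C (enumerate-∈ D j) d∈D
                                (trans sum≡z (sym c⊕d≡z)))

  isClique? : ∀ (K : Subset (suc n)) → Decidable (IsClique n K)
  isClique? K C = all? λ x → all? λ y →
    x ∈? C →-dec (y ∈? C →-dec (¬? (x ≟ᶠ y) →-dec (x ⊖ y ∈? K)))

  cliqueNumber-below : ∀ K k → (∀ C → IsClique n K C → ∣ C ∣ ≤ k) → ∃ (IsCliqueNumber n K)
  cliqueNumber-below K k bound with anySubset? (λ C → isClique? K C ×-dec ∣ C ∣ ≟ℕ k)
  ... | yes (C , C-clique , ∣C∣≡k) = k , (C , C-clique , ∣C∣≡k) , bound
  cliqueNumber-below K zero    bound | no none =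
    contradiction (⊥ , (λ _ _ x∈⊥ → contradiction x∈⊥ ∉⊥) , ∣⊥∣≡0 (M n)) none
  cliqueNumber-below K (suc k) bound | no none = cliqueNumber-below K k λ C C-clique →
    s≤s⁻¹ (≤∧≢⇒< (bound C C-clique) (λ ∣C∣≡1+k → none (C , C-clique , ∣C∣≡1+k)))

  cliqueNumber-exists : ∀ K → ∃ (IsCliqueNumber n K)
  cliqueNumber-exists K = cliqueNumber-below K (M n) (λ C _ → ∣p∣≤n C)

  tiling⇒cliqueNumbers : ∀ {H A B : Subset (suc n)} → Tiling n A B →
                         SubsetOf n (DivStar n A) H → SubsetOf n (DivStar n B) (compl n H) →
                         ∀ a b → IsCliqueNumber n H a → IsCliqueNumber n (compl n H) b → a * b ≡ M n
  tiling⇒cliqueNumbers {A = A} {B} tiling A⊆H B⊆H′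
                       _ _ ((C , C-clique , refl) , a-max) ((D , D-clique , refl) , b-max) =
    ≤-antisym (injective⇒≤ (sumIndex-injective C-clique D-clique)) (begin
      M n            ≤⟨ surjective⇒≤ (tiling⇒sumIndex-surjective tiling) ⟩
      ∣ A ∣ * ∣ B ∣  ≤⟨ *-mono-≤ (a-max A (DivStar⊆⇒isClique A⊆H))
                                 (b-max B (DivStar⊆⇒isClique B⊆H′)) ⟩
      ∣ C ∣ * ∣ D ∣  ∎)
    where open ≤-Reasoning

  cliqueNumbers⇒tiling : ∀ {H : Subset (suc n)} → UnionOfStepClasses n H → Fin.zero ∈ H →
                         (∀ a b → IsCliqueNumber n H a → IsCliqueNumber n (compl n H) b → a * b ≡ M n) →
                         ∃[ A ] ∃[ B ] (Tiling n A B × SubsetOf n (DivStar n A) H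
                                                    × SubsetOf n (DivStar n B) (compl n H))
  cliqueNumbers⇒tiling {H} H-union 0∈H ab≡M
    with cliqueNumber-exists H | cliqueNumber-exists (compl n H)
  ... | _ , ωH@((C , C-clique , refl) , _) | _ , ωH′@((D , D-clique , refl) , _) =
    C , D , cliques⇒tiling C-clique D-clique (≤-reflexive (sym (ab≡M _ _ ωH ωH′))) ,
    isClique⇒DivStar⊆ H-union 0∈H C-clique ,
    isClique⇒DivStar⊆ (compl-unionOfStepClasses H-union) (zero∈compl H) D-clique

proposition2p3 : (n : ℕ) → (H : Subset (suc n)) →
    UnionOfStepClasses n H → Fin.zero ∈ H →
    (∃[ A ] ∃[ B ] (Tiling n A B × SubsetOf n (DivStar n A) H × SubsetOf n (DivStar n B) (compl n H)))
    ⇔ (∀ a b → IsCliqueNumber n H a → IsCliqueNumber n (compl n H) b → a * b ≡ suc n)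
proposition2p3 n H H-union 0∈H =
  mk⇔ (λ (A , B , tiling , A⊆H , B⊆H′) → tiling⇒cliqueNumbers tiling A⊆H B⊆H′)
      (cliqueNumbers⇒tiling H-union 0∈H)
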